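{- Let $F$ be a balanced forest, and let $(A,B)$ be a bipartition of $F$ such that every vertex of $B$ has even degree in $F$. Then the edges of $F$ can be coloured with two colours such that each colour class induces a locally irregular graph and, for each vertex $v\in B$, all edges incident with $v$ have the same colour. In particular, $\chi'_{\rm irr}(F)\leq 2$.
   Context: All graphs are finite and simple. A forest is balanced if it has a bipartition such that all vertices in one of the partition classes have even degree. A graph is locally irregular if any two adjacent vertices have distinct degrees; a colour class induces the subgraph formed by the edges of that colour. $\chi'_{\rm irr}(F)$ is the least number of colours in an edge-colouring of $F$ in which every colour class induces a locally irregular graph. -}

module Defs where

open import Data.Nat using (ℕ; zero; suc; _+_; _≤_)
open import Data.Nat.Divisibility using (_∣_)
open import Data.Bool using (Bool; true; false; if_then_else_)
open import Data.Fin using (Fin)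
import Data.Fin as Fin
open import Data.List using (List; []; _∷_; _++_; length)
open import Data.List.Relation.Unary.Linked using (Linked)
open import Data.List.Relation.Unary.Unique.Propositional using (Unique)
open import Data.Product using (Σ; _×_)
open import Relation.Binary.PropositionalEquality using (_≡_; _≢_)
open import Relation.Nullary using (¬_)

count : ∀ {n} → (Fin n → Bool) → ℕ
count {zero}  p = 0
count {suc n} p = (if p Fin.zero then 1 else 0) + count (λ i → p (Fin.suc i))

_∧_ : Bool → Bool → Bool
true ∧ b = b
false ∧ b = false

record Graph (n : ℕ) : Set where
  field
    adj    : Fin n → Fin n → Bool
    sym    : ∀ u v → adj u v ≡ adj v u
    irrefl : ∀ v → adj v v ≡ false
open Graph public

Adj : ∀ {n} → Graph n → Fin n → Fin n → Set
Adj G u v = adj G u v ≡ true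

deg : ∀ {n} → Graph n → Fin n → ℕ
deg G v = count (adj G v)

Cycle : ∀ {n} → Graph n → Set
Cycle {n} G = Σ (Fin n) λ x → Σ (List (Fin n)) λ xs →
  (2 ≤ length xs) × Unique (x ∷ xs) × Linked (Adj G) (x ∷ xs ++ x ∷ [])

IsForest : ∀ {n} → Graph n → Set
IsForest G = ¬ Cycle G

-- bipartition given by side : Fin n → Bool (A = side false, B = side true);
-- every edge joins A and B
IsBipartition : ∀ {n} → Graph n → (Fin n → Bool) → Set
IsBipartition G side = ∀ u v → Adj G u v → side u ≢ side v

IsEdgeColouring : ∀ {n} → Graph n → (Fin n → Fin n → Bool) → Set
IsEdgeColouring G c = ∀ u v → Adj G u v → c u v ≡ c v u

colDeg : ∀ {n} → Graph n → (Fin n → Fin n → Bool) → Bool → Fin n → ℕ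
colDeg G c i v = count (λ u → adj G v u ∧ (if c v u then i else not' i))
  where
    not' : Bool → Bool
    not' true = false
    not' false = true

ClassLocallyIrregular : ∀ {n} → Graph n → (Fin n → Fin n → Bool) → Bool → Set
ClassLocallyIrregular G c i =
  ∀ u v → Adj G u v → c u v ≡ i → colDeg G c i u ≢ colDeg G c i v

Even : ℕ → Set
Even d = 2 ∣ d

-- Colour each vertex of B and give every edge the colour of its B-endpoint.  A B-vertex then has
-- even degree in its colour class, so it suffices to choose the colours so that every A-vertex has,
-- in each colour, either no neighbours or an odd number of them.  Rooting every tree at a B-vertex
-- and colouring top-down achieves this: an A-vertex whose parent has colour c and which has k
-- children gives all children colour c when k is even and the other colour when k is odd.
module Submission where

open import Defs hiding (sym)
import Data.Nat.Properties as ℕ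
open import Algebra.Properties.CommutativeSemigroup ℕ.+-commutativeSemigroup using (x∙yz≈y∙xz)
open import Data.Bool using (Bool; true; false; if_then_else_; not)
open import Data.Bool.Properties using (not-¬)
open import Data.Empty using (⊥-elim)
open import Data.Fin using (Fin; _≟_)
import Data.Fin as Fin
open import Data.Fin.Properties using (suc-injective)
open import Data.List using (List; []; _∷_; _++_; [_]; length)
open import Data.List.Relation.Unary.All using (All; []; _∷_)
import Data.List.Relation.Unary.All as All
import Data.List.Relation.Unary.All.Properties as All
open import Data.List.Relation.Unary.AllPairs using ([]; _∷_)
import Data.List.Relation.Unary.AllPairs.Properties as AllPairs
open import Data.List.Relation.Unary.Linked using (Linked; []; [-]; _∷_)
open import Data.List.Relation.Unary.Unique.Propositional using (Unique)
open import Data.Maybe using (Maybe; just; nothing; is-just)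
open import Data.Nat using (ℕ; zero; suc; _+_; _≤_; z≤n; s≤s; s≤s⁻¹; parity)
open import Data.Nat.Divisibility using (divides)
open import Data.Parity using (0ℙ; 1ℙ; _⁻¹)
open import Data.Parity.Properties using (*-homo-*; *-zeroʳ; suc-homo-⁻¹; ⁻¹-selfInverse)
open import Data.Product using (Σ; ∃; _×_; _,_; proj₁; proj₂)
open import Data.Sum using (_⊎_; inj₁; inj₂)
open import Data.Vec.Functional using (updateAt)
open import Data.Vec.Functional.Properties using (updateAt-updates; updateAt-minimal)
open import Function using (_∘_; const; case_of_)
open import Relation.Binary.PropositionalEquality
  using (_≡_; _≢_; refl; sym; trans; cong; cong₂; subst; ≢-sym)
open import Relation.Nullary using (¬_; yes; no)

same : Bool → Bool → Bool
same b i = if b then i else not i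

same-refl : ∀ b → same b b ≡ true
same-refl true  = refl
same-refl false = refl

∧-identityʳ : ∀ b → b ∧ true ≡ b
∧-identityʳ true  = refl
∧-identityʳ false = refl

∧-zeroʳ : ∀ b → b ∧ false ≡ false
∧-zeroʳ true  = refl
∧-zeroʳ false = refl

∧-true : ∀ {a b} → a ∧ b ≡ true → a ≡ true × b ≡ true
∧-true {true} b≡true = refl , b≡true

∧-falseʳ : ∀ {a b} → a ≡ true → a ∧ b ≡ false → b ≡ false
∧-falseʳ refl b≡false = b≡false

is-just-false : ∀ {A : Set} {m : Maybe A} → is-just m ≡ false → m ≡ nothing
is-just-false {m = nothing} _ = refl

is-just-true : ∀ {A : Set} {m : Maybe A} → is-just m ≡ true → ∃ λ a → m ≡ just a
is-just-true {m = just a} _ = a , refl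

colDeg-same : ∀ {n} (G : Graph n) c i v →
  colDeg G c i v ≡ count (λ u → adj G v u ∧ same (c v u) i)
colDeg-same G c true  v = refl
colDeg-same G c false v = refl

count-cong : ∀ {n} {p q : Fin n → Bool} → (∀ i → p i ≡ q i) → count p ≡ count q
count-cong {zero}          p≗q = refl
count-cong {suc n} {p} {q} p≗q rewrite p≗q Fin.zero =
  cong (_ +_) (count-cong (p≗q ∘ Fin.suc))

count-false : ∀ {n} {p : Fin n → Bool} → (∀ i → p i ≡ false) → count p ≡ 0
count-false {zero}      p≗false = refl
count-false {suc n} {p} p≗false rewrite p≗false Fin.zero = count-false (p≗false ∘ Fin.suc)

count-≢0 : ∀ {n} (p : Fin n → Bool) x → p x ≡ true → count p ≢ 0
count-≢0 p Fin.zero    px rewrite px = λ ()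
count-≢0 p (Fin.suc x) px with p Fin.zero
... | true  = λ ()
... | false = count-≢0 (p ∘ Fin.suc) x px

count-true : ∀ n → count {n} (const true) ≡ n
count-true zero    = refl
count-true (suc n) = cong suc (count-true n)

count-∧-const : ∀ {n} (p : Fin n → Bool) b → count (λ i → p i ∧ b) ≡ (if b then count p else 0)
count-∧-const p true  = count-cong (∧-identityʳ ∘ p)
count-∧-const p false = count-false (∧-zeroʳ ∘ p)

count-split : ∀ {n} {p q : Fin n → Bool} x → q x ≡ false → (∀ u → u ≢ x → p u ≡ q u) →
  count p ≡ (if p x then 1 else 0) + count q
count-split Fin.zero qx≡false p≗q rewrite qx≡false =
  cong (_ +_) (count-cong λ u → p≗q (Fin.suc u) λ ())
count-split {p = p} {q} (Fin.suc x) qx≡false p≗q rewrite p≗q Fin.zero (λ ()) =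
  trans (cong (_ +_) (count-split x qx≡false λ u u≢x → p≗q (Fin.suc u) (u≢x ∘ suc-injective)))
        (x∙yz≈y∙xz (if q Fin.zero then 1 else 0) (if p (Fin.suc x) then 1 else 0) (count (q ∘ Fin.suc)))

find : ∀ {n} (p : Fin n → Bool) → (∃ λ i → p i ≡ true) ⊎ (∀ i → p i ≡ false)
find {zero} p = inj₂ λ ()
find {suc n} p with p Fin.zero in p0
... | true  = inj₁ (Fin.zero , p0)
... | false with find (p ∘ Fin.suc)
...   | inj₁ (i , pi) = inj₁ (Fin.suc i , pi)
...   | inj₂ none     = inj₂ λ { Fin.zero → p0 ; (Fin.suc i) → none i }

module _ {A : Set} where

  unique-∷ʳ : ∀ {xs : List A} {x} → Unique xs → All (_≢ x) xs → Unique (xs ++ [ x ])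
  unique-∷ʳ uniq xs≢x = AllPairs.++⁺ uniq ([] ∷ []) (All.map (_∷ []) xs≢x)

  linked-∷ʳ : ∀ {R : A → A → Set} (xs : List A) {v x} →
    Linked R (xs ++ [ v ]) → R v x → Linked R ((xs ++ [ v ]) ++ [ x ])
  linked-∷ʳ []          [-]       Rvx = Rvx ∷ [-]
  linked-∷ʳ (_ ∷ [])    (R′ ∷ rs) Rvx = R′ ∷ linked-∷ʳ [] rs Rvx
  linked-∷ʳ (_ ∷ y ∷ xs) (R′ ∷ rs) Rvx = R′ ∷ linked-∷ʳ (y ∷ xs) rs Rvx

  length-∷ʳ-positive : ∀ (xs : List A) {x} → 1 ≤ length (xs ++ [ x ])
  length-∷ʳ-positive []      = s≤s z≤n
  length-∷ʳ-positive (_ ∷ _) = s≤s z≤n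

OddOrZero : ℕ → Set
OddOrZero m = m ≡ 0 ⊎ parity m ≡ 1ℙ

even⇒parity≡0ℙ : ∀ {m} → Even m → parity m ≡ 0ℙ
even⇒parity≡0ℙ (divides q refl) = trans (*-homo-* q 2) (*-zeroʳ (parity q))

nonzero-odd : ∀ {m} → OddOrZero m → m ≢ 0 → parity m ≡ 1ℙ
nonzero-odd (inj₁ m≡0) m≢0 = ⊥-elim (m≢0 m≡0)
nonzero-odd (inj₂ odd) _   = odd

parity-suc : ∀ {k} → parity k ≡ 0ℙ → parity (suc k) ≡ 1ℙ
parity-suc {k} pk = trans (sym (⁻¹-selfInverse (suc-homo-⁻¹ k))) (cong _⁻¹ pk)

flipBy : Data.Parity.Parity → Bool → Bool
flipBy 0ℙ c = c
flipBy 1ℙ c = not c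

-- The two colour counts of an A-vertex with a parent of colour c and k children of colour flipBy (parity k) c.
flipBy-balances : ∀ c i k →
  OddOrZero ((if same c i then 1 else 0) + (if same (flipBy (parity k) c) i then k else 0))
flipBy-balances c i k with parity k in pk
flipBy-balances true  true  k | 0ℙ = inj₂ (parity-suc {k} pk)
flipBy-balances true  false k | 0ℙ = inj₁ refl
flipBy-balances false true  k | 0ℙ = inj₁ refl
flipBy-balances false false k | 0ℙ = inj₂ (parity-suc {k} pk)
flipBy-balances true  true  k | 1ℙ = inj₂ refl
flipBy-balances true  false k | 1ℙ = inj₂ pk
flipBy-balances false true  k | 1ℙ = inj₂ pk
flipBy-balances false false k | 1ℙ = inj₂ refl

module BalancedForest {n} (F : Graph n) (side : Fin n → Bool)
                      (forest : IsForest F) (bip : IsBipartition F side) where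

  VertexSet VertexColouring : Set
  VertexSet       = Fin n → Bool
  VertexColouring = Fin n → Bool

  -- For a B-vertex, the colour it must receive; for an A-vertex, the colour of its already
  -- coloured (and deleted) parent.
  Prescription : Set
  Prescription = Fin n → Maybe Bool

  adj-sym : ∀ {u v} → Adj F u v → Adj F v u
  adj-sym {u} {v} uv = trans (Graph.sym F v u) uv

  adj-irrefl : ∀ {u v} → Adj F u v → u ≢ v
  adj-irrefl {u} uu refl = case trans (sym uu) (Graph.irrefl F u) of λ ()

  side-flip : ∀ {u v} → Adj F u v → side v ≡ not (side u)
  side-flip {u} {v} uv with side u in su | side v in sv
  ... | true  | false = refl
  ... | false | true  = refl
  ... | true  | true  = ⊥-elim (bip u v uv (trans su (sym sv)))
  ... | false | false = ⊥-elim (bip u v uv (trans su (sym sv)))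

  same-side-nonadjacent : ∀ {u v} → side u ≡ side v → adj F u v ≡ false
  same-side-nonadjacent {u} {v} su≡sv with adj F u v in uv
  ... | true  = ⊥-elim (bip u v uv su≡sv)
  ... | false = refl

  A-neighbour-in-B : ∀ {a u} → side a ≡ false → Adj F a u → side u ≡ true
  A-neighbour-in-B sa au = trans (side-flip au) (cong not sa)

  B-neighbour-in-A : ∀ {b u} → side b ≡ true → Adj F b u → side u ≡ false
  B-neighbour-in-A sb bu = trans (side-flip bu) (cong not sb)

  _∖_ : VertexSet → Fin n → VertexSet
  S ∖ x = updateAt S x (const false)

  ∖-self : ∀ S x → (S ∖ x) x ≡ false
  ∖-self S x = updateAt-updates x S

  ∖-other : ∀ S {x u} → u ≢ x → (S ∖ x) u ≡ S u
  ∖-other S {x} {u} u≢x = updateAt-minimal u x S u≢x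

  ∖-member : ∀ {S x u} → (S ∖ x) u ≡ true → S u ≡ true × u ≢ x
  ∖-member {S} {x} {u} Su with u ≟ x
  ... | yes refl = case trans (sym Su) (∖-self S x) of λ ()
  ... | no u≢x   = trans (sym (∖-other S u≢x)) Su , u≢x

  count-∖ : ∀ {S x k} → S x ≡ true → count S ≤ suc k → count (S ∖ x) ≤ k
  count-∖ {S} {x} {k} Sx size = s≤s⁻¹ (subst (_≤ suc k) S≡1+S∖x size)
    where
      S≡1+S∖x : count S ≡ suc (count (S ∖ x))
      S≡1+S∖x = trans (count-split x (∖-self S x) λ u u≢x → sym (∖-other S u≢x))
                      (cong (λ b → (if b then 1 else 0) + count (S ∖ x)) Sx)

  degreeIn : VertexSet → Fin n → ℕ
  degreeIn S x = count (λ u → S u ∧ adj F x u)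

  prescribeAround : Fin n → Bool → Prescription → Prescription
  prescribeAround x e pre w = if adj F x w then just e else pre w

  inherited : Maybe Bool → Bool → ℕ
  inherited nothing  i = 0
  inherited (just c) i = if same c i then 1 else 0

  nbCount : VertexSet → VertexColouring → Fin n → Bool → ℕ
  nbCount S col a i = count (λ u → S u ∧ (adj F a u ∧ same (col u) i))

  Respects : VertexSet → Prescription → VertexColouring → Set
  Respects S pre col = ∀ v c → S v ≡ true → side v ≡ true → pre v ≡ just c → col v ≡ c

  OddClasses : VertexSet → Prescription → VertexColouring → Set
  OddClasses S pre col = ∀ a i → S a ≡ true → side a ≡ false →
    OddOrZero (inherited (pre a) i + nbCount S col a i)

  Solution : VertexSet → Prescription → Set
  Solution S pre = Σ VertexColouring λ col → Respects S pre col × OddClasses S pre col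

  Path : VertexSet → Fin n → Fin n → Set
  Path S u v = Σ (List (Fin n)) λ xs →
    Unique (u ∷ xs ++ [ v ]) × Linked (Adj F) (u ∷ xs ++ [ v ]) × All (λ w → S w ≡ true) (u ∷ xs ++ [ v ])

  -- So every component of the alive forest contains at most one prescribed vertex, its root.
  Separated : VertexSet → Prescription → Set
  Separated S pre = ∀ {u v b b′} → pre u ≡ just b → pre v ≡ just b′ → ¬ Path S u v

  edge-path : ∀ {S u v} → S u ≡ true → S v ≡ true → Adj F u v → Path S u v
  edge-path Su Sv uv = [] , (adj-irrefl uv ∷ []) ∷ [] ∷ [] , uv ∷ [-] , Su ∷ Sv ∷ []

  path-∖ : ∀ {S x u v} → Path (S ∖ x) u v → Path S u v
  path-∖ (xs , uniq , linked , alive) = xs , uniq , linked , All.map (proj₁ ∘ ∖-member) alive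

  path-cons : ∀ {S x u v} → S x ≡ true → Adj F x u → Path (S ∖ x) u v → Path S x v
  path-cons Sx xu (xs , uniq , linked , alive) =
    _ ∷ xs , All.map (≢-sym ∘ proj₂ ∘ ∖-member) alive ∷ uniq , xu ∷ linked ,
    Sx ∷ All.map (proj₁ ∘ ∖-member) alive

  path-snoc : ∀ {S x u v} → S x ≡ true → Adj F v x → Path (S ∖ x) u v → Path S u x
  path-snoc {v = v} Sx vx (xs , uniq , linked , alive) =
    xs ++ [ v ] , unique-∷ʳ uniq (All.map (proj₂ ∘ ∖-member) alive) ,
    linked-∷ʳ (_ ∷ xs) linked vx , All.∷ʳ⁺ (All.map (proj₁ ∘ ∖-member) alive) Sx

  cycle-through : ∀ {S x u v} → Adj F x u → Adj F v x → Path (S ∖ x) u v → Cycle F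
  cycle-through {x = x} {u} {v} xu vx (xs , uniq , linked , alive) =
    x , u ∷ xs ++ [ v ] , s≤s (length-∷ʳ-positive xs) ,
    All.map (≢-sym ∘ proj₂ ∘ ∖-member) alive ∷ uniq , linked-∷ʳ (x ∷ u ∷ xs) (xu ∷ linked) vx

  -- A new prescription next to a deleted root x would be joined to an old one through x,
  -- or two new ones would close a cycle through x.
  separated-∖ : ∀ {S pre x c} → Separated S pre → S x ≡ true → pre x ≡ just c →
    ∀ e → Separated (S ∖ x) (prescribeAround x e pre)
  separated-∖ {x = x} sep Sx px e {u} {v} pu pv path with adj F x u in xu | adj F x v in xv
  ... | false | false = sep pu pv (path-∖ path)
  ... | true  | false = sep px pv (path-cons Sx xu path)
  ... | false | true  = sep pu px (path-snoc Sx (adj-sym xv) path)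
  ... | true  | true  = forest (cycle-through xu (adj-sym xv) path)

  prescribed-only-at : ∀ {S : VertexSet} {pre : Prescription} {x c w b} → (∀ {v} → S v ≡ true → pre v ≡ nothing) →
    S w ≡ true → updateAt pre x (const (just c)) w ≡ just b → w ≡ x
  prescribed-only-at {pre = pre} {x} {w = w} free Sw pw with w ≟ x
  ... | yes w≡x = w≡x
  ... | no w≢x  = case trans (sym (free {w} Sw)) (trans (sym (updateAt-minimal w x pre w≢x)) pw) of λ ()

  separated-root : ∀ {S pre x c} → (∀ {v} → S v ≡ true → pre v ≡ nothing) →
    Separated S (updateAt pre x (const (just c)))
  separated-root free {u} {v} pu pv (xs , x≢ ∷ _ , _ , Su ∷ alive)
    with prescribed-only-at free Su pu | prescribed-only-at free (All.head (All.++⁻ʳ xs alive)) pv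
  ... | refl | refl = All.head (All.++⁻ʳ xs x≢) refl

  unprescribed-neighbour : ∀ {S pre x a c} → Separated S pre → S x ≡ true → pre x ≡ just c →
    S a ≡ true → Adj F a x → pre a ≡ nothing
  unprescribed-neighbour {pre = pre} {a = a} sep Sx px Sa ax with pre a in pa
  ... | nothing = refl
  ... | just _  = ⊥-elim (sep pa px (edge-path Sa Sx ax))

  nbCount-∖ : ∀ {S col col′ x} a i → (∀ u → u ≢ x → col′ u ≡ col u) →
    nbCount S col′ a i ≡ (if S x ∧ (adj F a x ∧ same (col′ x) i) then 1 else 0) + nbCount (S ∖ x) col a i
  nbCount-∖ {S} {col} {col′} {x} a i col′≗col = count-split x removed kept
    where
      removed : (S ∖ x) x ∧ (adj F a x ∧ same (col x) i) ≡ false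
      removed rewrite ∖-self S x = refl
      kept : ∀ u → u ≢ x → S u ∧ (adj F a u ∧ same (col′ u) i) ≡ (S ∖ x) u ∧ (adj F a u ∧ same (col u) i)
      kept u u≢x rewrite ∖-other S u≢x | col′≗col u u≢x = refl

  -- Deleting x moves its contribution to a's counts from the alive neighbours to the prescription.
  inherited-transfer : ∀ {S pre col col′ x e} a i → S x ≡ true → (∀ u → u ≢ x → col′ u ≡ col u) →
    (Adj F a x → pre a ≡ nothing × col′ x ≡ e) →
    inherited (pre a) i + nbCount S col′ a i ≡ inherited (prescribeAround x e pre a) i + nbCount (S ∖ x) col a i
  inherited-transfer {S} {pre} {col} {col′} {x} a i Sx col′≗col parent
    rewrite nbCount-∖ {S} {col} a i col′≗col | Sx | Graph.sym F x a with adj F a x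
  ... | false = refl
  ... | true rewrite proj₁ (parent refl) | proj₂ (parent refl) = refl

  extend-B : ∀ {S pre x b} → Separated S pre → S x ≡ true → side x ≡ true → pre x ≡ just b →
    Solution (S ∖ x) (prescribeAround x b pre) → Solution S pre
  extend-B {S} {pre} {x} {b} sep Sx sx px (col , respects , odd) = col′ , respects′ , odd′
    where
      col′ : VertexColouring
      col′ = updateAt col x (const b)
      col′≗col : ∀ u → u ≢ x → col′ u ≡ col u
      col′≗col u u≢x = updateAt-minimal u x col u≢x
      respects′ : Respects S pre col′
      respects′ v c Sv sv pv with v ≟ x
      ... | yes refl with trans (sym px) pv
      ...   | refl = updateAt-updates x col
      respects′ v c Sv sv pv | no v≢x =
        trans (col′≗col v v≢x)
              (respects v c (trans (∖-other S v≢x) Sv) sv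
                 (trans (cong (λ t → if t then just b else pre v) (same-side-nonadjacent (trans sx (sym sv)))) pv))
      odd′ : OddClasses S pre col′
      odd′ a i Sa sa = subst OddOrZero (sym (inherited-transfer {pre = pre} a i Sx col′≗col parent))
                                       (odd a i (trans (∖-other S a≢x) Sa) sa)
        where
          a≢x : a ≢ x
          a≢x refl = not-¬ sa sx
          parent : Adj F a x → pre a ≡ nothing × col′ x ≡ b
          parent ax = unprescribed-neighbour sep Sx px Sa ax , updateAt-updates x col

  extend-A : ∀ {S pre x c} → Separated S pre → S x ≡ true → side x ≡ false → pre x ≡ just c →
    Solution (S ∖ x) (prescribeAround x (flipBy (parity (degreeIn (S ∖ x) x)) c) pre) → Solution S pre
  extend-A {S} {pre} {x} {c} sep Sx sx px (col , respects , odd) = col , respects′ , odd′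
    where
      k : ℕ
      k = degreeIn (S ∖ x) x
      e : Bool
      e = flipBy (parity k) c
      respects′ : Respects S pre col
      respects′ v c′ Sv sv pv with adj F x v in xv
      ... | true  = ⊥-elim (sep px pv (edge-path Sx Sv xv))
      ... | false = respects v c′ (trans (∖-other S v≢x) Sv) sv
                      (trans (cong (λ t → if t then just e else pre v) xv) pv)
        where
          v≢x : v ≢ x
          v≢x refl = not-¬ sv sx
      children : ∀ i u → S u ∧ (adj F x u ∧ same (col u) i) ≡ ((S ∖ x) u ∧ adj F x u) ∧ same e i
      children i u with u ≟ x
      ... | yes refl rewrite Graph.irrefl F x | ∖-self S x = ∧-zeroʳ (S x)
      ... | no u≢x rewrite ∖-other S u≢x with S u in Su | adj F x u in xu
      ...   | false | _     = refl
      ...   | true  | false = refl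
      ...   | true  | true  = cong (λ b → same b i)
              (respects u e (trans (∖-other S u≢x) Su) (A-neighbour-in-B sx xu)
                 (cong (λ t → if t then just e else pre u) xu))
      nbCount-x : ∀ i → nbCount S col x i ≡ (if same e i then k else 0)
      nbCount-x i = trans (count-cong (children i)) (count-∧-const (λ u → (S ∖ x) u ∧ adj F x u) (same e i))
      odd′ : OddClasses S pre col
      odd′ a i Sa sa with a ≟ x
      ... | yes refl = subst OddOrZero (sym (cong₂ _+_ (cong (λ m → inherited m i) px) (nbCount-x i)))
                                       (flipBy-balances c i k)
      ... | no a≢x = subst OddOrZero (sym (inherited-transfer {pre = pre} {col} a i Sx (λ _ _ → refl) parent))
                                     (odd a i (trans (∖-other S a≢x) Sa) sa)
        where
          parent : Adj F a x → pre a ≡ nothing × col x ≡ e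
          parent ax = ⊥-elim (bip a x ax (trans sa (sym sx)))

  unprescribe : ∀ {S pre x c} → side x ≡ true → pre x ≡ nothing →
    Solution S (updateAt pre x (const (just c))) → Solution S pre
  unprescribe {S} {pre} {x} sx px (col , respects , odd) = col , respects′ , odd′
    where
      respects′ : Respects S pre col
      respects′ v c′ Sv sv pv with v ≟ x
      ... | yes refl = case trans (sym px) pv of λ ()
      ... | no v≢x   = respects v c′ Sv sv (trans (updateAt-minimal v x pre v≢x) pv)
      odd′ : OddClasses S pre col
      odd′ a i Sa sa = subst (λ m → OddOrZero (inherited m i + nbCount S col a i))
                             (updateAt-minimal a x pre a≢x) (odd a i Sa sa)
        where
          a≢x : a ≢ x
          a≢x refl = not-¬ sa sx

  isolated-A : ∀ {S pre} → (∀ {v} → S v ≡ true → pre v ≡ nothing) →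
    (∀ {v} → S v ≡ true → side v ≡ false) → Solution S pre
  isolated-A {S} {pre} free onlyA = const false , (λ v _ Sv sv _ → ⊥-elim (not-¬ sv (onlyA Sv))) , odd
    where
      odd : OddClasses S pre (const false)
      odd a i Sa sa rewrite free Sa = inj₁ (count-false no-neighbour)
        where
          no-neighbour : ∀ u → S u ∧ (adj F a u ∧ same false i) ≡ false
          no-neighbour u with S u in Su | adj F a u in au
          ... | false | _     = refl
          ... | true  | false = refl
          ... | true  | true  = ⊥-elim (not-¬ (A-neighbour-in-B sa au) (onlyA Su))

  Solver : ℕ → Set
  Solver k = ∀ S pre → count S ≤ k → Separated S pre → Solution S pre

  solve-from : ∀ {k S pre x c} → Solver k → count S ≤ suc k → Separated S pre →
    S x ≡ true → pre x ≡ just c → Solution S pre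
  solve-from {S = S} {x = x} {c} solve size sep Sx px with side x in sx
  ... | true  = extend-B sep Sx sx px (solve _ _ (count-∖ Sx size) (separated-∖ sep Sx px _))
  ... | false = extend-A sep Sx sx px (solve _ _ (count-∖ Sx size) (separated-∖ sep Sx px _))

  -- Delete a prescribed vertex if there is one; otherwise make some B-vertex a root.
  solve : ∀ k → Solver k
  solve k S pre size sep with find (λ v → S v ∧ is-just (pre v)) | find (λ v → S v ∧ side v)
  solve zero S pre size sep | inj₁ (x , hx) | _ =
    ⊥-elim (count-≢0 S x (proj₁ (∧-true hx)) (ℕ.n≤0⇒n≡0 size))
  solve (suc k) S pre size sep | inj₁ (x , hx) | _ =
    solve-from (solve k) size sep (proj₁ (∧-true hx)) (proj₂ (is-just-true (proj₂ (∧-true hx))))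
  solve zero S pre size sep | inj₂ _ | inj₁ (x , hx) =
    ⊥-elim (count-≢0 S x (proj₁ (∧-true hx)) (ℕ.n≤0⇒n≡0 size))
  solve (suc k) S pre size sep | inj₂ none | inj₁ (x , hx) =
    unprescribe {c = false} sx (free Sx) (solve-from (solve k) size (separated-root free) Sx (updateAt-updates x pre))
    where
      Sx : S x ≡ true
      Sx = proj₁ (∧-true hx)
      sx : side x ≡ true
      sx = proj₂ (∧-true hx)
      free : ∀ {v} → S v ≡ true → pre v ≡ nothing
      free Sv = is-just-false (∧-falseʳ Sv (none _))
  solve k S pre size sep | inj₂ none | inj₂ noB =
    isolated-A (λ Sv → is-just-false (∧-falseʳ Sv (none _))) (λ Sv → ∧-falseʳ Sv (noB _))

  starColouring : VertexColouring → Fin n → Fin n → Bool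
  starColouring col u v = if side u then col u else col v

  star-at-B : ∀ col {u} v → side u ≡ true → starColouring col u v ≡ col u
  star-at-B col v su rewrite su = refl

  star-at-A : ∀ col {u} v → side u ≡ false → starColouring col u v ≡ col v
  star-at-A col v su rewrite su = refl

  starColouring-edgeColouring : ∀ col → IsEdgeColouring F (starColouring col)
  starColouring-edgeColouring col u v uv with side u in su
  ... | true  = sym (star-at-A col u (B-neighbour-in-A su uv))
  ... | false = sym (star-at-B col u (A-neighbour-in-B su uv))

  starColouring-stars : ∀ col v u w → side v ≡ true → starColouring col v u ≡ starColouring col v w
  starColouring-stars col v u w sv = trans (star-at-B col u sv) (sym (star-at-B col w sv))

  colDeg-star-B : ∀ {col b i} → side b ≡ true → col b ≡ i → colDeg F (starColouring col) i b ≡ deg F b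
  colDeg-star-B {col} {b} {i} sb cb = trans (colDeg-same F (starColouring col) i b) (count-cong λ w →
    trans (cong (λ t → adj F b w ∧ same t i) (trans (star-at-B col w sb) cb))
          (trans (cong (adj F b w ∧_) (same-refl i)) (∧-identityʳ (adj F b w))))

  colDeg-star-A : ∀ {col a i} → side a ≡ false → colDeg F (starColouring col) i a ≡ nbCount (const true) col a i
  colDeg-star-A {col} {a} {i} sa = trans (colDeg-same F (starColouring col) i a) (count-cong λ w →
    cong (λ t → adj F a w ∧ same t i) (star-at-A col w sa))

  -- The B-endpoint has even degree in the class, the A-endpoint a positive, hence odd, one.
  starColouring-irregular : ∀ {col} → OddClasses (const true) (const nothing) col →
    (∀ v → side v ≡ true → Even (deg F v)) → ∀ {i b a} → side b ≡ true → Adj F b a → col b ≡ i →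
    colDeg F (starColouring col) i b ≢ colDeg F (starColouring col) i a
  starColouring-irregular {col} odd even {i} {b} {a} sb ba cb b≡a =
    case trans (sym (even⇒parity≡0ℙ (even b sb))) (trans (cong parity deg-b≡count-a) count-a-odd) of λ ()
    where
      sa : side a ≡ false
      sa = B-neighbour-in-A sb ba
      deg-b≡count-a : deg F b ≡ nbCount (const true) col a i
      deg-b≡count-a = trans (sym (colDeg-star-B sb cb)) (trans b≡a (colDeg-star-A sa))
      b-counts : adj F a b ∧ same (col b) i ≡ true
      b-counts rewrite adj-sym ba | cb = same-refl i
      count-a-odd : parity (nbCount (const true) col a i) ≡ 1ℙ
      count-a-odd = nonzero-odd (odd a i refl sa) (count-≢0 _ b b-counts)

  starColouring-locallyIrregular : ∀ {col} → OddClasses (const true) (const nothing) col →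
    (∀ v → side v ≡ true → Even (deg F v)) → ∀ i → ClassLocallyIrregular F (starColouring col) i
  starColouring-locallyIrregular {col} odd even i u v uv cuv = by-side (side u) refl
    where
      by-side : ∀ s → side u ≡ s → colDeg F (starColouring col) i u ≢ colDeg F (starColouring col) i v
      by-side true  su = starColouring-irregular odd even su uv (trans (sym (star-at-B col v su)) cuv)
      by-side false su = ≢-sym (starColouring-irregular odd even (A-neighbour-in-B su uv) (adj-sym uv)
                                  (trans (sym (star-at-A col v su)) cuv))

lemma9 : ∀ {n : ℕ} (F : Graph n) (side : Fin n → Bool) →
    IsForest F → IsBipartition F side →
    (∀ v → side v ≡ true → Even (deg F v)) →
    Σ (Fin n → Fin n → Bool) λ c →
      IsEdgeColouring F c ×
      (∀ i → ClassLocallyIrregular F c i) ×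
      (∀ v u w → side v ≡ true → Adj F v u → Adj F v w → c v u ≡ c v w)
lemma9 {n} F side forest bip even =
  starColouring col , starColouring-edgeColouring col ,
  starColouring-locallyIrregular (proj₂ (proj₂ solution)) even ,
  λ v u w sv _ _ → starColouring-stars col v u w sv
  where
    open BalancedForest F side forest bip
    solution : Solution (const true) (const nothing)
    solution = solve n _ _ (ℕ.≤-reflexive (count-true n)) λ ()
    col : VertexColouring
    col = proj₁ solution
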